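{- Let $\mathtt{I}$ be an instance of SPA-P and let $\mathtt{J}$ be the integer program associated with $\mathtt{I}$ (defined in the context). If $S$ is a feasible solution to $\mathtt{J}$, then $M=\{(s_i,p_j)\in\mathcal{S}\times\mathcal{P}: x_{i,j}=1 \text{ in } S\}$ is a stable matching in $\mathtt{I}$, and $obj(S)=|M|$, where $obj(S)$ is the value of the objective function of $\mathtt{J}$ at $S$.
   Context: SPA-P instance: students $\mathcal{S}=\{s_1,\dots,s_{n_1}\}$, projects $\mathcal{P}=\{p_1,\dots,p_{n_2}\}$, lecturers $\mathcal{L}=\{l_1,\dots,l_{n_3}\}$. Each lecturer $l_k$ offers a non-empty set $P_k\subseteq\mathcal{P}$, and $P_1,\dots,P_{n_3}$ partition $\mathcal{P}$. Each student $s_i$ has an acceptable set $A_i\subseteq\mathcal{P}$ ranked in strict order of preference; each lecturer $l_k$ ranks $P_k$ in strict order. Each project $p_j$ has capacity $c_j\ge1$ and each lecturer $l_k$ capacity $d_k\ge1$ (positive integers). $(s_i,p_j)$ is acceptable if $p_j\in A_i$. A matching $M$ is a set of acceptable pairs with each student in at most one pair, $|M(p_j)|\le c_j$ and $|M(l_k)|\le d_k$, where $M(p_j)$ is the set of students assigned to $p_j$ and $M(l_k)$ the set of students assigned to projects in $P_k$; $M(s_i)$ is the project of $s_i$. A project (lecturer) is undersubscribed if it has fewer assigned students than its capacity, full if equal; $p_j$ is non-empty if $|M(p_j)|>0$. An acceptable pair $(s_i,p_j)\notin M$, with $p_j\in P_k$, is a blocking pair if $s_i$ is unassigned or prefers $p_j$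 to $M(s_i)$, $p_j$ is undersubscribed, and either (a) $s_i\in M(l_k)$ and $l_k$ prefers $p_j$ to $M(s_i)$, or (b) $s_i\notin M(l_k)$ and $l_k$ is undersubscribed, or (c) $s_i\notin M(l_k)$ and $l_k$ prefers $p_j$ to his worst non-empty project. A coalition is a set $\{s_{i_0},\dots,s_{i_{r-1}}\}$, $r\ge2$, of assigned students such that each $s_{i_t}$ prefers $M(s_{i_{t+1}})$ to $M(s_{i_t})$ (indices mod $r$). $M$ is stable if it has no blocking pair and no coalition. The IP $\mathtt{J}$: $rank(s_i,p_j)$ is $1+$ the number of projects $s_i$ prefers to $p_j$; similarly $rank(l_k,p_j)$. Let $S_{i,j}=\{p_{j'}\in A_i: rank(s_i,p_{j'})\le rank(s_i,p_j)\}$, $T_{k,j}=\{p_q\in P_k: rank(l_k,p_j)<rank(l_k,p_q)\}$, $D_{k,j}=\{p_{j'}\in P_k: rank(l_k,p_{j'})\le rank(l_k,p_j)\}$. Variables: binary $x_{i,j}$ for each acceptable pair $(s_i,p_j)$ (sums below range over existing variables only); binary $\alpha_j$ for each project; binary $\delta_k$ for each lecturer; binary $\eta_{j,k}$; binary $e_{i,i'}$ for each ordered pair of distinct students; integer $v_i$ for each student. Abbreviations: $\theta_{i,j}=1-\sum_{p_{j'}\in S_{i,j}}x_{i,j'}$, $\gamma_{i,j,k}=\sum_{p_{j'}\in T_{k,j}}x_{i,j'}$, $\beta_{i,k}=\sum_{p_{j'}\in P_k}x_{i,j'}$. Constraints: (1) $\sum_{p_j\in A_i}x_{i,j}\le1$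 for all $i$; (2) $\sum_{i}x_{i,j}\le c_j$ for all $j$; (3) $\sum_i\sum_{p_j\in P_k}x_{i,j}\le d_k$ for all $k$; (4) $c_j\alpha_j\ge c_j-\sum_{i'}x_{i',j}$ for all $j$; (5) $d_k\delta_k\ge d_k-\sum_{i'}\sum_{p_{j'}\in P_k}x_{i',j'}$ for all $k$; (6) $d_k\eta_{j,k}\ge d_k-\sum_{i'}\sum_{p_{j'}\in D_{k,j}}x_{i',j'}$ for all $k$ and $p_j\in P_k$; and for every acceptable pair $(s_i,p_j)$ with $p_j\in P_k$: (7) $\theta_{i,j}+\alpha_j+\gamma_{i,j,k}\le2$, (8) $\theta_{i,j}+\alpha_j+(1-\beta_{i,k})+\delta_k\le3$, (9) $\theta_{i,j}+\alpha_j+(1-\beta_{i,k})+\eta_{j,k}\le3$; (10) for all distinct $i,i'$ and all $j,j'$ such that $s_i$ prefers $p_{j'}$ to $p_j$: $e_{i,i'}+1\ge x_{i,j}+x_{i',j'}$; (11) for all distinct $i,i'$: $v_i<v_{i'}+n_1(1-e_{i,i'})$. Objective: maximise $\sum_i\sum_{p_j\in A_i}x_{i,j}$. -}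

module Defs where

open import Data.Nat as ℕ using (ℕ; zero; suc; _≤_; _<_)
open import Data.Integer as ℤ using (ℤ; +_)
open import Data.Fin using (Fin; zero; suc; inject₁; fromℕ; _≟_)
open import Data.Bool using (Bool; true; false; if_then_else_; _∧_; _∨_)
open import Data.List using (List; []; _∷_; length; lookup)
open import Data.List.Membership.Propositional using (_∈_)
open import Data.List.Relation.Unary.Unique.Propositional using (Unique)
open import Data.Product using (Σ; ∃; _×_; _,_)
open import Data.Sum using (_⊎_)
open import Function using (_∘_)
open import Data.Unit using (⊤; tt)
open import Function.Definitions using (Injective)
open import Relation.Binary.PropositionalEquality using (_≡_; _≢_)
open import Relation.Nullary using (¬_; Dec; yes; no)
open import Relation.Nullary.Decidable using (⌊_⌋; _×-dec_)
open import Relation.Unary using (Decidable)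

sumℤ : (n : ℕ) → (Fin n → ℤ) → ℤ
sumℤ zero    f = + 0
sumℤ (suc n) f = f zero ℤ.+ sumℤ n (f ∘ suc)

sumℤ-if : (n : ℕ) {P : Fin n → Set} → Decidable P → (Fin n → ℤ) → ℤ
sumℤ-if n P? f = sumℤ n (λ t → if ⌊ P? t ⌋ then f t else + 0)

sumℕ : (n : ℕ) → (Fin n → ℕ) → ℕ
sumℕ zero    f = 0
sumℕ (suc n) f = f zero ℕ.+ sumℕ n (f ∘ suc)

count : (n : ℕ) → (Fin n → Bool) → ℕ
count n b = sumℕ n (λ t → if b t then 1 else 0)

anyFin : (n : ℕ) → (Fin n → Bool) → Bool
anyFin zero    b = false
anyFin (suc n) b = b zero ∨ anyFin n (b ∘ suc)

-- position (0-based) of the first occurrence of p in a list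
-- (length of the list if p does not occur)
posIn : {m : ℕ} → Fin m → List (Fin m) → ℕ
posIn p []      = 0
posIn p (q ∷ l) with p ≟ q
... | yes _ = 0
... | no  _ = suc (posIn p l)

-- SPA-P instances
-- students Fin n₁, projects Fin n₂, lecturers Fin n₃

record SPAP : Set where
  field
    n₁ n₂ n₃   : ℕ
    -- lec j = the lecturer offering project j (so the P_k partition the projects)
    lec        : Fin n₂ → Fin n₃
    offers     : (k : Fin n₃) → ∃ λ j → lec j ≡ k
    -- student preference list: A_i in strict order of preference (most preferred first)
    spref      : Fin n₁ → List (Fin n₂)
    spref-uniq : (i : Fin n₁) → Unique (spref i)
    lpref      : Fin n₃ → List (Fin n₂)
    lpref-uniq : (k : Fin n₃) → Unique (lpref k)
    lpref-sound : (k : Fin n₃) (j : Fin n₂) → j ∈ lpref k → lec j ≡ k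
    lpref-compl : (k : Fin n₃) (j : Fin n₂) → lec j ≡ k → j ∈ lpref k
    c          : Fin n₂ → ℕ
    c-pos      : (j : Fin n₂) → 1 ≤ c j
    d          : Fin n₃ → ℕ
    d-pos      : (k : Fin n₃) → 1 ≤ d k

module _ (I : SPAP) where
  open SPAP I

  -- rank(s_i, p) = 1 + number of projects s_i prefers to p (for p ∈ A_i)
  srank : Fin n₁ → Fin n₂ → ℕ
  srank i p = suc (posIn p (spref i))

  lrank : Fin n₃ → Fin n₂ → ℕ
  lrank k p = suc (posIn p (lpref k))

  acceptable : Fin n₁ → Fin n₂ → Set
  acceptable i p = p ∈ spref i

  sPrefers : Fin n₁ → Fin n₂ → Fin n₂ → Set
  sPrefers i p q = p ∈ spref i × q ∈ spref i × srank i p < srank i q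

  lPrefers : Fin n₃ → Fin n₂ → Fin n₂ → Set
  lPrefers k p q = lec p ≡ k × lec q ≡ k × lrank k p < lrank k q

  PairSet : Set
  PairSet = Fin n₁ → Fin n₂ → Bool

  module _ (M : PairSet) where

    cardP : Fin n₂ → ℕ
    cardP j = count n₁ (λ i → M i j)

    cardL : Fin n₃ → ℕ
    cardL k = count n₁ (λ i → anyFin n₂ (λ j → ⌊ lec j ≟ k ⌋ ∧ M i j))

    size : ℕ
    size = sumℕ n₁ (λ i → count n₂ (M i))

    record IsMatching : Set where
      field
        accept  : (i : Fin n₁) (j : Fin n₂) → M i j ≡ true → acceptable i j
        single  : (i : Fin n₁) (j j' : Fin n₂) → M i j ≡ true → M i j' ≡ true → j ≡ j'
        capP    : (j : Fin n₂) → cardP j ≤ c j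
        capL    : (k : Fin n₃) → cardL k ≤ d k

    assigned : Fin n₁ → Set
    assigned i = ∃ λ q → M i q ≡ true

    inL : Fin n₁ → Fin n₃ → Set
    inL i k = ∃ λ q → M i q ≡ true × lec q ≡ k

    nonEmpty : Fin n₂ → Set
    nonEmpty j = 0 < cardP j

    worstNonEmpty : Fin n₃ → Fin n₂ → Set
    worstNonEmpty k w = lec w ≡ k × nonEmpty w ×
      ((w' : Fin n₂) → lec w' ≡ k → nonEmpty w' → lrank k w' ≤ lrank k w)

    BlockingPair : Fin n₁ → Fin n₂ → Set
    BlockingPair i j =
      acceptable i j × M i j ≡ false ×
      (¬ assigned i ⊎ (∃ λ q → M i q ≡ true × sPrefers i j q)) ×
      cardP j < c j ×
      ( (∃ λ q → M i q ≡ true × lec q ≡ lec j × lPrefers (lec j) j q)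
      ⊎ (¬ inL i (lec j) × cardL (lec j) < d (lec j))
      ⊎ (¬ inL i (lec j) ×
           (∃ λ w → worstNonEmpty (lec j) w × lPrefers (lec j) j w)) )

    -- a coalition {s_{f 0}, …, s_{f (r-1)}} with r = m + 2 distinct assigned
    -- students, g t = M(s_{f t}), each student preferring the project of the next
    -- (cyclically)
    record Coalition : Set where
      field
        m     : ℕ
        f     : Fin (suc (suc m)) → Fin n₁
        f-inj : Injective _≡_ _≡_ f
        g     : Fin (suc (suc m)) → Fin n₂
        g-ok  : (t : Fin (suc (suc m))) → M (f t) (g t) ≡ true
        step  : (t : Fin (suc m)) → sPrefers (f (inject₁ t)) (g (suc t)) (g (inject₁ t))
        close : sPrefers (f (fromℕ (suc m))) (g zero) (g (fromℕ (suc m)))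

    record Stable : Set where
      field
        noBlocking  : (i : Fin n₁) (j : Fin n₂) → ¬ BlockingPair i j
        noCoalition : ¬ Coalition

  -- The integer program J.
  -- The variable x_{i,j} for the acceptable pair (s_i , p_j) is indexed by the
  -- position t of p_j in s_i's preference list: x i t, with p_j = proj i t.

  proj : (i : Fin n₁) → Fin (length (spref i)) → Fin n₂
  proj i t = lookup (spref i) t

  record Solution : Set where
    field
      x : (i : Fin n₁) → Fin (length (spref i)) → ℕ
      α : Fin n₂ → ℕ
      δ : Fin n₃ → ℕ
      η : Fin n₂ → Fin n₃ → ℕ
      e : Fin n₁ → Fin n₁ → ℕ
      v : Fin n₁ → ℤ

  module _ (S : Solution) where
    open Solution S

    xsum : (i : Fin n₁) {P : Fin n₂ → Set} → Decidable P → ℤ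
    xsum i P? = sumℤ-if (length (spref i)) (P? ∘ proj i) (λ t → + x i t)

    xsumAll : {P : Fin n₂ → Set} → Decidable P → ℤ
    xsumAll P? = sumℤ n₁ (λ i → xsum i P?)

    θ : Fin n₁ → Fin n₂ → ℤ
    θ i j = + 1 ℤ.- xsum i (λ p → srank i p ℕ.≤? srank i j)

    γ : Fin n₁ → Fin n₂ → Fin n₃ → ℤ
    γ i j k = xsum i (λ q → lec q ≟ k ×-dec (lrank k j ℕ.<? lrank k q))

    β : Fin n₁ → Fin n₃ → ℤ
    β i k = xsum i (λ q → lec q ≟ k)

    record Feasible : Set where
      field
        x-bin : (i : Fin n₁) (t : Fin (length (spref i))) → x i t ≤ 1
        α-bin : (j : Fin n₂) → α j ≤ 1
        δ-bin : (k : Fin n₃) → δ k ≤ 1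
        η-bin : (j : Fin n₂) (k : Fin n₃) → η j k ≤ 1
        e-bin : (i i' : Fin n₁) → i ≢ i' → e i i' ≤ 1
        c1 : (i : Fin n₁) → xsum i {λ _ → ⊤} (λ _ → yes tt) ℤ.≤ + 1
        c2 : (j : Fin n₂) → xsumAll (λ p → p ≟ j) ℤ.≤ + c j
        c3 : (k : Fin n₃) → xsumAll (λ p → lec p ≟ k) ℤ.≤ + d k
        c4 : (j : Fin n₂) → + c j ℤ.* + α j ℤ.≥ + c j ℤ.- xsumAll (λ p → p ≟ j)
        c5 : (k : Fin n₃) → + d k ℤ.* + δ k ℤ.≥ + d k ℤ.- xsumAll (λ p → lec p ≟ k)
        c6 : (k : Fin n₃) (j : Fin n₂) → lec j ≡ k →
             + d k ℤ.* + η j k ℤ.≥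
               + d k ℤ.- xsumAll (λ p → lec p ≟ k ×-dec (lrank k p ℕ.≤? lrank k j))
        c7 : (i : Fin n₁) (t : Fin (length (spref i))) →
             let j = proj i t ; k = lec j in
             θ i j ℤ.+ + α j ℤ.+ γ i j k ℤ.≤ + 2
        c8 : (i : Fin n₁) (t : Fin (length (spref i))) →
             let j = proj i t ; k = lec j in
             θ i j ℤ.+ + α j ℤ.+ (+ 1 ℤ.- β i k) ℤ.+ + δ k ℤ.≤ + 3
        c9 : (i : Fin n₁) (t : Fin (length (spref i))) →
             let j = proj i t ; k = lec j in
             θ i j ℤ.+ + α j ℤ.+ (+ 1 ℤ.- β i k) ℤ.+ + η j k ℤ.≤ + 3
        c10 : (i i' : Fin n₁) → i ≢ i' →
              (t : Fin (length (spref i))) (t' : Fin (length (spref i'))) →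
              sPrefers i (proj i' t') (proj i t) →
              + e i i' ℤ.+ + 1 ℤ.≥ + x i t ℤ.+ + x i' t'
        c11 : (i i' : Fin n₁) → i ≢ i' →
              v i ℤ.< v i' ℤ.+ + n₁ ℤ.* (+ 1 ℤ.- + e i i')

    obj : ℕ
    obj = sumℕ n₁ (λ i → sumℕ (length (spref i)) (x i))

  matchingOf : Solution → PairSet
  matchingOf S i j =
    anyFin (length (spref i)) (λ t → ⌊ proj i t ≟ j ⌋ ∧ ⌊ Solution.x S i t ℕ.≟ 1 ⌋)

module Submission where

-- Constraint (1) together with binarity says that the row x_i of each
-- student is either zero or a unit vector; hence every student s_i has an
-- optional chosen project  chosen i  (the project whose variable is 1), and
-- every sum of x-variables appearing in J collapses to an indicator
-- "the chosen project of s_i satisfies P".  In these terms M(p_j), M(l_k),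
-- θ, β, γ and the sets of constraint (6) become simple counts.
--   * Matching: (2), (3) are the capacity conditions.
--   * No blocking pair: the student part of a blocking pair forces θ = 1,
--     an undersubscribed project forces α = 1 by (4); the three lecturer
--     cases force γ = 1, resp. β = 0 and δ = 1 by (5), resp. β = 0 and
--     η = 1 by (6); each contradicts (7), (8), resp. (9).
--   * No coalition: by (10) and (11) the potential v strictly increases
--     along a coalition, which is impossible around a cycle.
--   * obj(S) = |M| since both count the students with a chosen project.

open import Defs
open import Data.Bool using (Bool; true; false; if_then_else_; _∧_; _∨_)
open import Data.Bool.Properties using (∧-zeroʳ; ∧-identityʳ; ∨-identityʳ)
open import Data.Empty using (⊥; ⊥-elim)
open import Data.Fin using (Fin; zero; suc; inject₁; fromℕ; toℕ; _≟_)
open import Data.Fin.Properties using (suc-injective; toℕ-inject₁)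
open import Data.Integer as ℤ using (ℤ; +_; +≤+)
import Data.Integer.Properties as ℤ
open import Data.List using (length)
open import Data.List.Membership.Propositional.Properties using (∈-lookup)
open import Data.List.Relation.Unary.Any using (index)
open import Data.List.Relation.Unary.Any.Properties using (lookup-index)
open import Data.Maybe using (Maybe; just; nothing)
open import Data.Maybe.Properties using (just-injective)
open import Data.Nat as ℕ using (ℕ; zero; suc; _+_; _≤_; _<_; z≤n; s≤s)
import Data.Nat.Properties as ℕ
open import Algebra.Properties.CommutativeSemigroup ℕ.+-commutativeSemigroup using (interchange)
open import Data.Product using (_×_; _,_; proj₁; proj₂; ∃)
open import Data.Sum using (_⊎_; inj₁; inj₂)
open import Data.Unit using (tt)
open import Function using (_∘_)
open import Relation.Binary.PropositionalEquality
  using (_≡_; _≢_; refl; sym; trans; cong; cong₂; subst; subst₂; module ≡-Reasoning)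
open import Relation.Nullary using (¬_; Dec; yes; no; _×-dec_)
open import Relation.Nullary.Decidable using (⌊_⌋)
open import Relation.Unary using (Decidable)

ind : Bool → ℕ
ind b = if b then 1 else 0

⌊⌋-sound : ∀ {P : Set} (P? : Dec P) → ⌊ P? ⌋ ≡ true → P
⌊⌋-sound (yes p) _ = p
⌊⌋-sound (no _) ()

⌊⌋-complete : ∀ {P : Set} (P? : Dec P) → P → ⌊ P? ⌋ ≡ true
⌊⌋-complete (yes _) _ = refl
⌊⌋-complete (no ¬p) p = ⊥-elim (¬p p)

⌊⌋-refute : ∀ {P : Set} (P? : Dec P) → ¬ P → ⌊ P? ⌋ ≡ false
⌊⌋-refute (yes p) ¬p = ⊥-elim (¬p p)
⌊⌋-refute (no _) _ = refl

if-zero : ∀ c {a} → a ≡ 0 → (if c then a else 0) ≡ 0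
if-zero true  a≡0 = a≡0
if-zero false _   = refl

if-one : ∀ c {a} → a ≡ 1 → (if c then a else 0) ≡ ind c
if-one true  a≡1 = a≡1
if-one false _   = refl

∧-is-one-zero : ∀ c {a} → a ≡ 0 → c ∧ ⌊ a ℕ.≟ 1 ⌋ ≡ false
∧-is-one-zero c refl = ∧-zeroʳ c

∧-is-one-one : ∀ c {a} → a ≡ 1 → c ∧ ⌊ a ℕ.≟ 1 ⌋ ≡ c
∧-is-one-one c refl = ∧-identityʳ c

inject₁≢suc : ∀ {n} (t : Fin n) → inject₁ t ≢ suc t
inject₁≢suc t eq = ℕ.<-irrefl (trans (sym (toℕ-inject₁ t)) (cong toℕ eq)) (ℕ.n<1+n (toℕ t))

sumℕ-cong : ∀ n {f g : Fin n → ℕ} → (∀ t → f t ≡ g t) → sumℕ n f ≡ sumℕ n g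
sumℕ-cong zero    f≡g = refl
sumℕ-cong (suc n) f≡g = cong₂ _+_ (f≡g zero) (sumℕ-cong n (f≡g ∘ suc))

sumℕ-zero : ∀ n (f : Fin n → ℕ) → (∀ t → f t ≡ 0) → sumℕ n f ≡ 0
sumℕ-zero zero    f f≡0 = refl
sumℕ-zero (suc n) f f≡0 rewrite f≡0 zero = sumℕ-zero n (f ∘ suc) (f≡0 ∘ suc)

sumℕ-zero⁻ : ∀ n (f : Fin n → ℕ) → sumℕ n f ≡ 0 → ∀ t → f t ≡ 0
sumℕ-zero⁻ (suc n) f Σ≡0 zero    = ℕ.m+n≡0⇒m≡0 (f zero) Σ≡0
sumℕ-zero⁻ (suc n) f Σ≡0 (suc t) = sumℕ-zero⁻ n (f ∘ suc) (ℕ.m+n≡0⇒n≡0 (f zero) Σ≡0) t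

sumℕ-single : ∀ n (f : Fin n → ℕ) (t₀ : Fin n) → (∀ t → t ≢ t₀ → f t ≡ 0) → sumℕ n f ≡ f t₀
sumℕ-single (suc n) f zero f≡0
  rewrite sumℕ-zero n (f ∘ suc) (λ t → f≡0 (suc t) (λ ())) = ℕ.+-identityʳ (f zero)
sumℕ-single (suc n) f (suc t₀) f≡0
  rewrite f≡0 zero (λ ()) = sumℕ-single n (f ∘ suc) t₀ (λ t t≢ → f≡0 (suc t) (t≢ ∘ suc-injective))

sumℕ-+-≤ : ∀ n (f g h : Fin n → ℕ) → (∀ t → f t + g t ≤ h t) → sumℕ n f + sumℕ n g ≤ sumℕ n h
sumℕ-+-≤ zero    f g h _  = z≤n
sumℕ-+-≤ (suc n) f g h le
  rewrite interchange (f zero) (sumℕ n (f ∘ suc)) (g zero) (sumℕ n (g ∘ suc)) =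
  ℕ.+-mono-≤ (le zero) (sumℕ-+-≤ n (f ∘ suc) (g ∘ suc) (h ∘ suc) (le ∘ suc))

sumℤ-+ : ∀ n (F : Fin n → ℤ) (f : Fin n → ℕ) → (∀ t → F t ≡ + f t) → sumℤ n F ≡ + sumℕ n f
sumℤ-+ zero    F f F≡f = refl
sumℤ-+ (suc n) F f F≡f = cong₂ ℤ._+_ (F≡f zero) (sumℤ-+ n (F ∘ suc) (f ∘ suc) (F≡f ∘ suc))

anyFin-cong : ∀ n {b b' : Fin n → Bool} → (∀ t → b t ≡ b' t) → anyFin n b ≡ anyFin n b'
anyFin-cong zero    b≡b' = refl
anyFin-cong (suc n) b≡b' = cong₂ _∨_ (b≡b' zero) (anyFin-cong n (b≡b' ∘ suc))

anyFin-false : ∀ n (b : Fin n → Bool) → (∀ t → b t ≡ false) → anyFin n b ≡ false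
anyFin-false zero    b b≡f = refl
anyFin-false (suc n) b b≡f rewrite b≡f zero = anyFin-false n (b ∘ suc) (b≡f ∘ suc)

anyFin-single : ∀ n (b : Fin n → Bool) (t₀ : Fin n) → (∀ t → t ≢ t₀ → b t ≡ false) → anyFin n b ≡ b t₀
anyFin-single (suc n) b zero b≡f
  rewrite anyFin-false n (b ∘ suc) (λ t → b≡f (suc t) (λ ())) = ∨-identityʳ (b zero)
anyFin-single (suc n) b (suc t₀) b≡f
  rewrite b≡f zero (λ ()) = anyFin-single n (b ∘ suc) t₀ (λ t t≢ → b≡f (suc t) (t≢ ∘ suc-injective))

holds : {A : Set} → (A → Bool) → Maybe A → Bool
holds b nothing  = false
holds b (just a) = b a

holds-true : ∀ {A : Set} {b : A → Bool} {m : Maybe A} {a : A} → m ≡ just a → b a ≡ true → holds b m ≡ true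
holds-true refl ba = ba

holds-false : ∀ {A : Set} (b : A → Bool) (m : Maybe A) → (∀ a → m ≡ just a → b a ≡ false) → holds b m ≡ false
holds-false b nothing  _   = refl
holds-false b (just a) b≡f = b≡f a refl

holds-≟ : ∀ {n} {q : Fin n} (m : Maybe (Fin n)) → holds (λ p → ⌊ p ≟ q ⌋) m ≡ true → m ≡ just q
holds-≟ nothing ()
holds-≟ {q = q} (just p) p≡q = cong just (⌊⌋-sound (p ≟ q) p≡q)

count-point : ∀ n (m : Maybe (Fin n)) → count n (λ q → holds (λ p → ⌊ p ≟ q ⌋) m) ≡ ind (holds (λ _ → true) m)
count-point n nothing  = sumℕ-zero n _ (λ _ → refl)
count-point n (just p) =
  trans (sumℕ-single n _ p (λ q q≢p → cong ind (⌊⌋-refute (p ≟ q) (q≢p ∘ sym))))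
        (cong ind (⌊⌋-complete (p ≟ p) refl))

any-point : ∀ n (b : Fin n → Bool) (m : Maybe (Fin n)) →
            anyFin n (λ q → b q ∧ holds (λ p → ⌊ p ≟ q ⌋) m) ≡ holds b m
any-point n b nothing  = anyFin-false n _ (λ q → ∧-zeroʳ (b q))
any-point n b (just p) =
  trans (anyFin-single n _ p (λ q q≢p → trans (cong (b q ∧_) (⌊⌋-refute (p ≟ q) (q≢p ∘ sym))) (∧-zeroʳ (b q))))
        (trans (cong (b p ∧_) (⌊⌋-complete (p ≟ p) refl)) (∧-identityʳ (b p)))

ind-disjoint-≤ : ∀ {A : Set} (b₁ b₂ b : A → Bool) (m : Maybe A) →
                 (∀ a → b₁ a ≡ true → b₂ a ≡ true → ⊥) →
                 (∀ a → b₁ a ≡ true → b a ≡ true) → (∀ a → b₂ a ≡ true → b a ≡ true) →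
                 ind (holds b₁ m) + ind (holds b₂ m) ≤ ind (holds b m)
ind-disjoint-≤ b₁ b₂ b nothing  _ _ _ = z≤n
ind-disjoint-≤ b₁ b₂ b (just a) disjoint imp₁ imp₂ with b₁ a in e₁ | b₂ a in e₂
... | true  | true  = ⊥-elim (disjoint a e₁ e₂)
... | true  | false rewrite imp₁ a e₁ = ℕ.≤-refl
... | false | true  rewrite imp₂ a e₂ = ℕ.≤-refl
... | false | false = z≤n

data AtMostOne {n : ℕ} (f : Fin n → ℕ) : Set where
  none   : (∀ t → f t ≡ 0) → AtMostOne f
  one    : (t₀ : Fin n) → f t₀ ≡ 1 → (∀ t → t ≢ t₀ → f t ≡ 0) → AtMostOne f

atMostOne : ∀ n (f : Fin n → ℕ) → (∀ t → f t ≤ 1) → sumℕ n f ≤ 1 → AtMostOne f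
atMostOne zero    f binary total = none (λ ())
atMostOne (suc n) f binary total with ℕ.n≤1⇒n≡0∨n≡1 (binary zero)
... | inj₁ f₀≡0 with atMostOne n (f ∘ suc) (binary ∘ suc) (subst (λ z → z + sumℕ n (f ∘ suc) ≤ 1) f₀≡0 total)
...   | none rest       = none λ { zero → f₀≡0 ; (suc t) → rest t }
...   | one t₀ f≡1 rest = one (suc t₀) f≡1 λ { zero _ → f₀≡0 ; (suc t) t≢ → rest t (t≢ ∘ cong suc) }
atMostOne (suc n) f binary total | inj₂ f₀≡1 =
  one zero f₀≡1 λ { zero t≢ → ⊥-elim (t≢ refl) ; (suc t) _ → sumℕ-zero⁻ n (f ∘ suc) rest≡0 t }
  where
    rest≡0 : sumℕ n (f ∘ suc) ≡ 0
    rest≡0 = ℕ.n≤0⇒n≡0 (ℕ.+-cancelˡ-≤ 1 _ _ (subst (λ z → z + sumℕ n (f ∘ suc) ≤ 1) f₀≡1 total))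

choice : ∀ {n} {B : Set} {f : Fin n → ℕ} → (Fin n → B) → AtMostOne f → Maybe B
choice π (none _)     = nothing
choice π (one t₀ _ _) = just (π t₀)

filtered-sum : ∀ {n} {B : Set} {f : Fin n → ℕ} (π : Fin n → B) (b : B → Bool) (r : AtMostOne f) →
               sumℕ n (λ t → if b (π t) then f t else 0) ≡ ind (holds b (choice π r))
filtered-sum π b (none f≡0) = sumℕ-zero _ _ (λ t → if-zero (b (π t)) (f≡0 t))
filtered-sum π b (one t₀ f≡1 rest) =
  trans (sumℕ-single _ _ t₀ (λ t t≢ → if-zero (b (π t)) (rest t t≢))) (if-one (b (π t₀)) f≡1)

indicator-any : ∀ {n m} {f : Fin n → ℕ} (π : Fin n → Fin m) (q : Fin m) (r : AtMostOne f) →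
                anyFin n (λ t → ⌊ π t ≟ q ⌋ ∧ ⌊ f t ℕ.≟ 1 ⌋) ≡ holds (λ p → ⌊ p ≟ q ⌋) (choice π r)
indicator-any π q (none f≡0) = anyFin-false _ _ (λ t → ∧-is-one-zero (⌊ π t ≟ q ⌋) (f≡0 t))
indicator-any π q (one t₀ f≡1 rest) =
  trans (anyFin-single _ _ t₀ (λ t t≢ → ∧-is-one-zero (⌊ π t ≟ q ⌋) (rest t t≢))) (∧-is-one-one (⌊ π t₀ ≟ q ⌋) f≡1)

choice-position : ∀ {n} {B : Set} {f : Fin n → ℕ} (π : Fin n → B) (r : AtMostOne f) {q : B} →
                  choice π r ≡ just q → ∃ λ t → f t ≡ 1 × π t ≡ q
choice-position π (none _) ()
choice-position π (one t₀ f≡1 _) refl = t₀ , f≡1 , refl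

-- A binary variable a with c·a ≥ c − X, where X < c, must be 1
-- (constraints (4), (5), (6) for an undersubscribed project/lecturer).
binary-forced : ∀ a c X → a ≤ 1 → X < c → + c ℤ.- + X ℤ.≤ + c ℤ.* + a → a ≡ 1
binary-forced (suc zero)    c X _ _ _ = refl
binary-forced (suc (suc a)) c X (s≤s ()) _ _
binary-forced zero c X _ X<c c-X≤0
  rewrite ℤ.*-zeroʳ (+ c) | ℤ.m-n≡m⊖n c X | ℤ.⊖-≥ (ℕ.<⇒≤ X<c) =
  ⊥-elim (ℕ.<⇒≱ (ℕ.m<n⇒0<n∸m X<c) (ℤ.drop‿+≤+ c-X≤0))

c7-fails : ∀ {θ α γ : ℤ} → θ ≡ + 1 → α ≡ + 1 → γ ≡ + 1 → ¬ (θ ℤ.+ α ℤ.+ γ ℤ.≤ + 2)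
c7-fails refl refl refl (+≤+ (s≤s (s≤s ())))

c89-fails : ∀ {θ α β δ : ℤ} → θ ≡ + 1 → α ≡ + 1 → β ≡ + 0 → δ ≡ + 1 →
            ¬ (θ ℤ.+ α ℤ.+ (+ 1 ℤ.- β) ℤ.+ δ ℤ.≤ + 3)
c89-fails refl refl refl refl (+≤+ (s≤s (s≤s (s≤s ()))))

e-forced : ∀ e → e ≤ 1 → + 1 ℤ.+ + 1 ℤ.≤ + e ℤ.+ + 1 → e ≡ 1
e-forced zero          _        (+≤+ (s≤s ()))
e-forced (suc zero)    _        _ = refl
e-forced (suc (suc e)) (s≤s ()) _

drop-slack : ∀ (a b : ℤ) n e → e ≡ 1 → a ℤ.< b ℤ.+ + n ℤ.* (+ 1 ℤ.- + e) → a ℤ.< b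
drop-slack a b n e refl a<b rewrite ℤ.*-zeroʳ (+ n) | ℤ.+-identityʳ b = a<b

increasing-chain : ∀ n (h : Fin (suc n) → ℤ) → (∀ (t : Fin n) → h (inject₁ t) ℤ.< h (suc t)) →
                   h zero ℤ.≤ h (fromℕ n)
increasing-chain zero    h _    = ℤ.≤-refl
increasing-chain (suc n) h step = ℤ.<⇒≤ (ℤ.<-≤-trans (step zero) (increasing-chain n (h ∘ suc) (step ∘ suc)))

module Feasible⇒Stable (I : SPAP) (S : Solution I) (feasible : Feasible I S) where
  open SPAP I
  open Solution S
  open Feasible feasible

  M : PairSet I
  M = matchingOf I S

  rowSum : (i : Fin n₁) {P : Fin n₂ → Set} → Decidable P → ℕ
  rowSum i P? = sumℕ (length (spref i)) (λ t → if ⌊ P? (proj I i t) ⌋ then x i t else 0)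

  xsum-rowSum : ∀ i {P : Fin n₂ → Set} (P? : Decidable P) → xsum I S i P? ≡ + rowSum i P?
  xsum-rowSum i P? = sumℤ-+ _ _ _ (λ t → lift ⌊ P? (proj I i t) ⌋ (x i t))
    where
      lift : ∀ c a → (if c then + a else + 0) ≡ + (if c then a else 0)
      lift true  a = refl
      lift false a = refl

  -- Constraint (1) and binarity: each row of x is zero or a unit vector.
  row : (i : Fin n₁) → AtMostOne (x i)
  row i = atMostOne _ (x i) (x-bin i) (ℤ.drop‿+≤+ (subst (ℤ._≤ + 1) (xsum-rowSum i (λ _ → yes tt)) (c1 i)))

  chosen : Fin n₁ → Maybe (Fin n₂)
  chosen i = choice (proj I i) (row i)

  xsum-chosen : ∀ i {P : Fin n₂ → Set} (P? : Decidable P) →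
                xsum I S i P? ≡ + ind (holds (λ p → ⌊ P? p ⌋) (chosen i))
  xsum-chosen i P? = trans (xsum-rowSum i P?) (cong +_ (filtered-sum (proj I i) _ (row i)))

  M-chosen : ∀ i j → M i j ≡ holds (λ p → ⌊ p ≟ j ⌋) (chosen i)
  M-chosen i j = indicator-any (proj I i) j (row i)

  chosen-of : ∀ {i q} → M i q ≡ true → chosen i ≡ just q
  chosen-of {i} {q} m = holds-≟ (chosen i) (trans (sym (M-chosen i q)) m)

  M-of : ∀ {i q} → chosen i ≡ just q → M i q ≡ true
  M-of {i} {q} eq = trans (M-chosen i q) (holds-true eq (⌊⌋-complete (q ≟ q) refl))

  position : ∀ {i q} → M i q ≡ true → ∃ λ t → x i t ≡ 1 × proj I i t ≡ q
  position {i} m = choice-position (proj I i) (row i) (chosen-of m)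

  countChosen : {P : Fin n₂ → Set} → Decidable P → ℕ
  countChosen P? = sumℕ n₁ (λ i → ind (holds (λ p → ⌊ P? p ⌋) (chosen i)))

  xsumAll-count : ∀ {P : Fin n₂ → Set} (P? : Decidable P) → xsumAll I S P? ≡ + countChosen P?
  xsumAll-count P? = sumℤ-+ n₁ _ _ (λ i → xsum-chosen i P?)

  cardP-count : ∀ j → cardP I M j ≡ countChosen (λ p → p ≟ j)
  cardP-count j = sumℕ-cong n₁ (λ i → cong ind (M-chosen i j))

  cardL-count : ∀ k → cardL I M k ≡ countChosen (λ p → lec p ≟ k)
  cardL-count k = sumℕ-cong n₁ λ i → cong ind
    (trans (anyFin-cong n₂ (λ j → cong (⌊ lec j ≟ k ⌋ ∧_) (M-chosen i j))) (any-point n₂ _ (chosen i)))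

  isMatching : IsMatching I M
  isMatching = record { accept = accept ; single = single ; capP = capP ; capL = capL }
    where
      accept : ∀ i j → M i j ≡ true → acceptable I i j
      accept i j m with position m
      ... | t , _ , refl = ∈-lookup t
      single : ∀ i j j' → M i j ≡ true → M i j' ≡ true → j ≡ j'
      single i j j' m m' = just-injective (trans (sym (chosen-of m)) (chosen-of m'))
      capP : ∀ j → cardP I M j ≤ c j
      capP j rewrite cardP-count j = ℤ.drop‿+≤+ (subst (ℤ._≤ + c j) (xsumAll-count (λ p → p ≟ j)) (c2 j))
      capL : ∀ k → cardL I M k ≤ d k
      capL k rewrite cardL-count k = ℤ.drop‿+≤+ (subst (ℤ._≤ + d k) (xsumAll-count (λ p → lec p ≟ k)) (c3 k))

  θ-one : ∀ i j → (¬ assigned I M i ⊎ ∃ λ q → M i q ≡ true × sPrefers I i j q) → θ I S i j ≡ + 1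
  θ-one i j wants = cong (λ z → + 1 ℤ.- z) (trans (xsum-chosen i _) (cong (+_ ∘ ind) (holds-false _ (chosen i) (noBetter wants))))
    where
      noBetter : (¬ assigned I M i ⊎ ∃ λ q → M i q ≡ true × sPrefers I i j q) →
                 ∀ p → chosen i ≡ just p → ⌊ srank I i p ℕ.≤? srank I i j ⌋ ≡ false
      noBetter (inj₁ unassigned) p eq = ⊥-elim (unassigned (p , M-of eq))
      noBetter (inj₂ (q , m , _ , _ , j≺q)) p eq with just-injective (trans (sym (chosen-of m)) eq)
      ... | refl = ⌊⌋-refute (srank I i q ℕ.≤? srank I i j) (ℕ.<⇒≱ j≺q)

  β-zero : ∀ i k → ¬ inL I M i k → β I S i k ≡ + 0
  β-zero i k outside = trans (xsum-chosen i _) (cong (+_ ∘ ind) (holds-false _ (chosen i)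
    λ p eq → ⌊⌋-refute (lec p ≟ k) (λ lp≡k → outside (p , M-of eq , lp≡k))))

  γ-one : ∀ i j q → M i q ≡ true → lPrefers I (lec j) j q → γ I S i j (lec j) ≡ + 1
  γ-one i j q m (_ , lq , j≺q) = trans (xsum-chosen i _) (cong (+_ ∘ ind) (holds-true (chosen-of m)
    (⌊⌋-complete (lec q ≟ lec j ×-dec (lrank I (lec j) j ℕ.<? lrank I (lec j) q)) (lq , j≺q))))

  α-forced : ∀ j → cardP I M j < c j → α j ≡ 1
  α-forced j under = binary-forced (α j) (c j) _ (α-bin j) (subst (_< c j) (cardP-count j) under)
    (subst (λ z → + c j ℤ.- z ℤ.≤ + c j ℤ.* + α j) (xsumAll-count (λ p → p ≟ j)) (c4 j))

  δ-forced : ∀ k → cardL I M k < d k → δ k ≡ 1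
  δ-forced k under = binary-forced (δ k) (d k) _ (δ-bin k) (subst (_< d k) (cardL-count k) under)
    (subst (λ z → + d k ℤ.- z ℤ.≤ + d k ℤ.* + δ k) (xsumAll-count (λ p → lec p ≟ k)) (c5 k))

  upTo? : (j : Fin n₂) → Decidable (λ p → lec p ≡ lec j × lrank I (lec j) p ≤ lrank I (lec j) j)
  upTo? j p = lec p ≟ lec j ×-dec (lrank I (lec j) p ℕ.≤? lrank I (lec j) j)

  -- Students on D_{k,j} and students on a project w of l_k worse than p_j are
  -- disjoint sets of students of l_k.
  count-upTo : ∀ j w → lec w ≡ lec j → lrank I (lec j) j < lrank I (lec j) w →
               countChosen (upTo? j) + cardP I M w ≤ cardL I M (lec j)
  count-upTo j w lw≡k j≺w = begin
      countChosen (upTo? j) + cardP I M w                   ≡⟨ cong (λ z → countChosen (upTo? j) + z) (cardP-count w) ⟩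
      countChosen (upTo? j) + countChosen (λ p → p ≟ w)     ≤⟨ sumℕ-+-≤ n₁ _ _ _ (λ i → ind-disjoint-≤ _ _ _ (chosen i) disjoint fromUpTo fromW) ⟩
      countChosen (λ p → lec p ≟ lec j)                     ≡⟨ sym (cardL-count (lec j)) ⟩
      cardL I M (lec j)                                     ∎
    where
      open ℕ.≤-Reasoning
      disjoint : ∀ p → ⌊ upTo? j p ⌋ ≡ true → ⌊ p ≟ w ⌋ ≡ true → ⊥
      disjoint p inD p≡w with ⌊⌋-sound (p ≟ w) p≡w
      ... | refl = ℕ.<⇒≱ j≺w (proj₂ (⌊⌋-sound (upTo? j p) inD))
      fromUpTo : ∀ p → ⌊ upTo? j p ⌋ ≡ true → ⌊ lec p ≟ lec j ⌋ ≡ true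
      fromUpTo p inD = ⌊⌋-complete (lec p ≟ lec j) (proj₁ (⌊⌋-sound (upTo? j p) inD))
      fromW : ∀ p → ⌊ p ≟ w ⌋ ≡ true → ⌊ lec p ≟ lec j ⌋ ≡ true
      fromW p p≡w with ⌊⌋-sound (p ≟ w) p≡w
      ... | refl = ⌊⌋-complete (lec w ≟ lec j) lw≡k

  -- Case (c): if l_k prefers p_j to a non-empty project w, then fewer than d_k
  -- students sit on D_{k,j}, so η_{j,k} = 1 by (6).
  η-forced : ∀ j w → worstNonEmpty I M (lec j) w → lPrefers I (lec j) j w → η j (lec j) ≡ 1
  η-forced j w (lw≡k , nonEmpty , _) (_ , _ , j≺w) =
    binary-forced (η j k) (d k) X (η-bin j k) X<d
      (subst (λ z → + d k ℤ.- z ℤ.≤ + d k ℤ.* + η j k) (xsumAll-count (upTo? j)) (c6 k j refl))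
    where
      open ℕ.≤-Reasoning
      k = lec j
      X = countChosen (upTo? j)
      X<d : X < d k
      X<d = begin-strict
        X                   ≡⟨ sym (ℕ.+-identityʳ X) ⟩
        X + 0               <⟨ ℕ.+-monoʳ-< X nonEmpty ⟩
        X + cardP I M w     ≤⟨ count-upTo j w lw≡k j≺w ⟩
        cardL I M k         ≤⟨ IsMatching.capL isMatching k ⟩
        d k                 ∎

  noBlockingAt : ∀ i t → ¬ BlockingPair I M i (proj I i t)
  noBlockingAt i t (_ , _ , wants , under , inj₁ (q , m , _ , j≺q)) =
    c7-fails (θ-one i _ wants) (cong +_ (α-forced _ under)) (γ-one i _ q m j≺q) (c7 i t)
  noBlockingAt i t (_ , _ , wants , under , inj₂ (inj₁ (outside , underL))) =
    c89-fails (θ-one i _ wants) (cong +_ (α-forced _ under)) (β-zero i _ outside) (cong +_ (δ-forced _ underL)) (c8 i t)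
  noBlockingAt i t (_ , _ , wants , under , inj₂ (inj₂ (outside , w , worst , j≺w))) =
    c89-fails (θ-one i _ wants) (cong +_ (α-forced _ under)) (β-zero i _ outside) (cong +_ (η-forced _ w worst j≺w)) (c9 i t)

  noBlocking : ∀ i j → ¬ BlockingPair I M i j
  noBlocking i j blocking@(acc , _) =
    noBlockingAt i (index acc) (subst (BlockingPair I M i) (lookup-index acc) blocking)

  v-increases : ∀ {i i' q q'} → i ≢ i' → M i q ≡ true → M i' q' ≡ true → sPrefers I i q' q → v i ℤ.< v i'
  v-increases {i} {i'} i≢i' m m' q'≻q with position m | position m'
  ... | t , xt≡1 , refl | t' , xt'≡1 , refl =
    drop-slack (v i) (v i') n₁ (e i i') (e-forced (e i i') (e-bin i i' i≢i') both) (c11 i i' i≢i')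
    where
      both : + 1 ℤ.+ + 1 ℤ.≤ + e i i' ℤ.+ + 1
      both = subst₂ (λ a b → + a ℤ.+ + b ℤ.≤ + e i i' ℤ.+ + 1) xt≡1 xt'≡1 (c10 i i' i≢i' t t' q'≻q)

  noCoalition : ¬ Coalition I M
  noCoalition co = ℤ.<-irrefl refl (ℤ.≤-<-trans forward back)
    where
      open Coalition co
      forward : v (f zero) ℤ.≤ v (f (fromℕ (suc m)))
      forward = increasing-chain (suc m) (v ∘ f)
        (λ t → v-increases (inject₁≢suc t ∘ f-inj) (g-ok (inject₁ t)) (g-ok (suc t)) (step t))
      back : v (f (fromℕ (suc m))) ℤ.< v (f zero)
      back = v-increases ((λ ()) ∘ f-inj) (g-ok (fromℕ (suc m))) (g-ok zero) close

  -- Both obj(S) and |M| count, student by student, whether a project is chosen.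
  obj-size : obj I S ≡ size I M
  obj-size = sumℕ-cong n₁ λ i → begin
    sumℕ (length (spref i)) (x i)                       ≡⟨ filtered-sum (proj I i) (λ _ → true) (row i) ⟩
    ind (holds (λ _ → true) (chosen i))                 ≡⟨ sym (count-point n₂ (chosen i)) ⟩
    count n₂ (λ q → holds (λ p → ⌊ p ≟ q ⌋) (chosen i)) ≡⟨ sumℕ-cong n₂ (λ q → cong ind (sym (M-chosen i q))) ⟩
    count n₂ (M i)                                      ∎
    where open ≡-Reasoning

lemma1 : (I : SPAP) (S : Solution I) → Feasible I S →
         IsMatching I (matchingOf I S) × Stable I (matchingOf I S) × obj I S ≡ size I (matchingOf I S)
lemma1 I S feasible =
  isMatching , record { noBlocking = noBlocking ; noCoalition = noCoalition } , obj-size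
  where open Feasible⇒Stable I S feasible
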